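{- Let $n \ge 2$, and let $r \ge 2$ and $s$ be integers with $\gcd(r,s)=1$. Then the cyclic system of $n$ simultaneous congruences $$ r\left(\frac{\prod_{k=1}^n q_k}{q_i}\right) \equiv s \pmod{|q_i|}, \qquad 1 \le i \le n, $$ has only finitely many integer solutions $(q_1, \dots, q_n) \in (\mathbb{Z}\setminus\{0\})^n$ with $\gcd(q_1 q_2 \cdots q_n, s) = 1$. All such solutions satisfy $$ \max_i\{q_i\} \le \left(r(n+1)\right)^{2^{n-1}} + |s|. $$ -}

module Defs where

open import Data.Nat using (ℕ)
open import Data.Integer using (ℤ; _*_; _-_; +_; ∣_∣; 1ℤ; 0ℤ)
open import Data.Integer.Divisibility using (_∣_)
open import Data.Integer.GCD using (gcd)
open import Data.Fin using (Fin; _≟_)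
open import Data.Vec using (Vec; foldr; tabulate; lookup)
open import Data.Bool using (if_then_else_)
open import Data.Product using (_×_)
open import Relation.Nullary.Decidable using (⌊_⌋)
open import Relation.Binary.PropositionalEquality using (_≡_; _≢_)

prodVec : ∀ {n} → Vec ℤ n → ℤ
prodVec = foldr _ _*_ 1ℤ

-- (∏_k q_k) / q_i, written as the product of all q_k with k ≠ i
-- (this equals the exact quotient since all q_k are nonzero)
prodExcept : ∀ {n} → Vec ℤ n → Fin n → ℤ
prodExcept q i = prodVec (tabulate λ j → if ⌊ j ≟ i ⌋ then 1ℤ else lookup q j)

IsSolution : ∀ {n} → ℤ → ℤ → Vec ℤ n → Set
IsSolution r s q =
  (∀ i → lookup q i ≢ 0ℤ)
  × (∀ i → (+ ∣ lookup q i ∣) ∣ (r * prodExcept q i - s))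
  × (gcd (prodVec q) s ≡ 1ℤ)

-- Each qᵢ divides r·∏_{j≠i} q_j − s, hence also r·e − s where e = Σᵢ ∏_{j≠i} q_j (the other
-- terms of e are multiples of qᵢ). The gcd condition makes the qᵢ pairwise coprime, so ∏ qᵢ
-- divides r·e − s, which is nonzero since r ∤ s; whence |∏ qᵢ| ≤ r|e| + |s|. Let m be an
-- entry of least absolute value. If |m| is large compared to r·n, this inequality forces
-- |∏_{j≠m} q_j| ≤ |s|, bounding everything. Otherwise m is small; substituting it into the
-- remaining n − 1 congruences turns the coefficient r into r·m and gives a system of the same
-- shape, so induction squares the bound at every step, which accounts for the exponent 2^{n-1}.
module Submission where

open import Defs
open import Data.Nat using (ℕ; suc; _∸_) renaming (_≤_ to _≤ℕ_; _^_ to _^ℕ_)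
open import Data.Integer using (ℤ; _*_; _+_; _≤_; _^_; +_; ∣_∣; 1ℤ)
open import Data.Integer.GCD using (gcd)
open import Data.Vec using (Vec; lookup)
open import Data.List using (List)
open import Data.List.Membership.Propositional using (_∈_)
open import Data.Product using (_×_; ∃-syntax)
open import Relation.Binary.PropositionalEquality using (_≡_)

open import Algebra.Bundles using (CommutativeMonoid)
open import Data.Nat using (zero; z≤n; s≤s; NonZero; ≢-nonZero; _≤?_)
  renaming (_+_ to _+ℕ_; _*_ to _*ℕ_; _<_ to _<ℕ_)
import Data.Nat.Properties as ℕ
import Data.Nat.Divisibility as ℕᵈ
open import Data.Nat.ListAction using (product)
open import Data.Nat.ListAction.Properties using (∈⇒≤product)
open import Data.Nat.Tactic.RingSolver using (solve-∀)
open import Data.Integer using (_-_; -_; 0ℤ; +≤+; -≤+; -[1+_]) renaming (≢-nonZero to ≢-nonZeroℤ)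
import Data.Integer.Properties as ℤ
import Data.Integer.Divisibility as Unsigned
open import Data.Integer.Divisibility.Signed
  using (_∣_; divides; ∣ᵤ⇒∣; ∣⇒∣ᵤ; ∣-refl; ∣-trans; m∣∣m∣; ∣m∣n⇒∣m+n; ∣m+n∣m⇒∣n; ∣m⇒∣-m;
         ∣m⇒∣m*n; ∣n⇒∣m*n; *-monoˡ-∣)
open import Data.Integer.Coprimality using (Coprime; coprime-divisor)
open import Data.Integer.GCD using (gcd-greatest)
import Data.Integer.Tactic.RingSolver as ℤ-Solver
open import Data.Fin using (Fin; zero; suc) renaming (_≟_ to _≟ᶠ_)
open import Data.Bool using (if_then_else_)
open import Relation.Nullary.Decidable using (⌊⌋-map′)
open import Algebra.Properties.CommutativeSemigroup ℤ.*-commutativeSemigroup using (x∙yz≈y∙xz)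
open import Data.Vec using ([]; _∷_; toList)
open import Data.Vec.Properties using (tabulate∘lookup; tabulate-cong; length-toList)
open import Data.Vec.Membership.Propositional using () renaming (_∈_ to _∈ᵥ_)
open import Data.Vec.Membership.Propositional.Properties using (∈-lookup; ∈-toList⁺; ∈-toList⁻)
open import Data.Vec.Relation.Unary.Any using (index)
open import Data.Vec.Relation.Unary.Any.Properties using (lookup-index)
open import Data.List using ([]; _∷_; length; map; foldr; upTo; _++_; cartesianProductWith)
open import Data.List.Relation.Unary.All as All using (All; []; _∷_)
import Data.List.Relation.Unary.All.Properties as All
open import Data.List.Relation.Unary.Any using (here)
open import Data.List.Relation.Binary.Permutation.Propositional as ↭
  using (_↭_; ↭-sym; ↭⇒↭ₛ)
open import Data.List.Relation.Binary.Permutation.Propositional.Properties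
  using (All-resp-↭; ∈-resp-↭; ↭-length)
open import Data.List.Relation.Binary.Permutation.Setoid.Properties using (foldr-commMonoid)
open import Data.List.Membership.Propositional.Properties
  using (∈-map⁺; ∈-++⁺ˡ; ∈-++⁺ʳ; ∈-upTo⁺; ∈-cartesianProductWith⁺)
open import Data.Product using (_,_)
open import Relation.Nullary using (¬_; yes; no)
open import Relation.Binary.PropositionalEquality using (refl; sym; trans; cong; subst; _≢_; module ≡-Reasoning)
open import Function using (_∘_)

prodList : List ℤ → ℤ
prodList = foldr _*_ 1ℤ

sumProdExcept : List ℤ → ℤ
sumProdExcept []       = 0ℤ
sumProdExcept (x ∷ xs) = prodList xs + x * sumProdExcept xs

prodList-↭ : ∀ {xs ys} → xs ↭ ys → prodList xs ≡ prodList ys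
prodList-↭ σ = foldr-commMonoid ℤ*.setoid ℤ*.isCommutativeMonoid (↭⇒↭ₛ σ)
  where module ℤ* = CommutativeMonoid ℤ.*-1-commutativeMonoid

∣prodList∣≡product : ∀ xs → ∣ prodList xs ∣ ≡ product (map ∣_∣ xs)
∣prodList∣≡product []       = refl
∣prodList∣≡product (x ∷ xs) = trans (ℤ.abs-* x (prodList xs)) (cong (∣ x ∣ *ℕ_) (∣prodList∣≡product xs))

∈⇒∣∣≤∣prodList∣ : ∀ {x xs} → All (_≢ 0ℤ) xs → x ∈ xs → ∣ x ∣ ≤ℕ ∣ prodList xs ∣
∈⇒∣∣≤∣prodList∣ {x} {xs} nz x∈xs =
  subst (∣ x ∣ ≤ℕ_) (sym (∣prodList∣≡product xs))
    (∈⇒≤product (All.map⁺ (All.map (λ x≢0 → ≢-nonZero (x≢0 ∘ ℤ.∣i∣≡0⇒i≡0)) nz))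
                 (∈-map⁺ ∣_∣ x∈xs))

∣sumProdExcept-∷∣≤ : ∀ x xs →
  ∣ sumProdExcept (x ∷ xs) ∣ ≤ℕ ∣ prodList xs ∣ +ℕ ∣ x ∣ *ℕ ∣ sumProdExcept xs ∣
∣sumProdExcept-∷∣≤ x xs =
  ℕ.≤-trans (ℤ.∣i+j∣≤∣i∣+∣j∣ (prodList xs) (x * sumProdExcept xs))
    (ℕ.≤-reflexive (cong (∣ prodList xs ∣ +ℕ_) (ℤ.abs-* x (sumProdExcept xs))))

min*∣sumProdExcept∣≤ : ∀ μ xs → All (λ y → μ ≤ℕ ∣ y ∣) xs →
  μ *ℕ ∣ sumProdExcept xs ∣ ≤ℕ length xs *ℕ ∣ prodList xs ∣
min*∣sumProdExcept∣≤ μ []       []          = ℕ.≤-reflexive (ℕ.*-zeroʳ μ)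
min*∣sumProdExcept∣≤ μ (x ∷ xs) (μ≤x ∷ μ≤xs) = begin
  μ *ℕ ∣ sumProdExcept (x ∷ xs) ∣        ≤⟨ ℕ.*-monoʳ-≤ μ (∣sumProdExcept-∷∣≤ x xs) ⟩
  μ *ℕ (p +ℕ ∣ x ∣ *ℕ e)                ≡⟨ distrib μ p ∣ x ∣ e ⟩
  μ *ℕ p +ℕ ∣ x ∣ *ℕ (μ *ℕ e)           ≤⟨ ℕ.+-mono-≤ (ℕ.*-monoˡ-≤ p μ≤x)
                                             (ℕ.*-monoʳ-≤ ∣ x ∣ (min*∣sumProdExcept∣≤ μ xs μ≤xs)) ⟩
  ∣ x ∣ *ℕ p +ℕ ∣ x ∣ *ℕ (length xs *ℕ p) ≡⟨ collect ∣ x ∣ p (length xs) ⟩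
  suc (length xs) *ℕ (∣ x ∣ *ℕ p)        ≡⟨ cong (suc (length xs) *ℕ_) (ℤ.abs-* x (prodList xs)) ⟨
  suc (length xs) *ℕ ∣ prodList (x ∷ xs) ∣ ∎
  where
  open ℕ.≤-Reasoning
  p : ℕ
  p = ∣ prodList xs ∣
  e : ℕ
  e = ∣ sumProdExcept xs ∣
  distrib : ∀ μ p x e → μ *ℕ (p +ℕ x *ℕ e) ≡ μ *ℕ p +ℕ x *ℕ (μ *ℕ e)
  distrib = solve-∀
  collect : ∀ x p l → x *ℕ p +ℕ x *ℕ (l *ℕ p) ≡ suc l *ℕ (x *ℕ p)
  collect = solve-∀

∣sumProdExcept∣≤-minimum-first : ∀ {m rest} → All (λ y → ∣ m ∣ ≤ℕ ∣ y ∣) rest →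
  ∣ sumProdExcept (m ∷ rest) ∣ ≤ℕ length (m ∷ rest) *ℕ ∣ prodList rest ∣
∣sumProdExcept∣≤-minimum-first {m} {rest} m≤rest =
  ℕ.≤-trans (∣sumProdExcept-∷∣≤ m rest)
    (ℕ.+-monoʳ-≤ ∣ prodList rest ∣ (min*∣sumProdExcept∣≤ ∣ m ∣ rest m≤rest))

extract-minimum : ∀ {A : Set} (f : A → ℕ) x xs →
  ∃[ m ] ∃[ rest ] (x ∷ xs ↭ m ∷ rest) × All (λ y → f m ≤ℕ f y) rest
extract-minimum f x [] = x , [] , ↭.refl , []
extract-minimum f x (y ∷ ys) with extract-minimum f y ys
... | m , rest , σ , m≤rest with f x ≤? f m
...   | yes x≤m = x , m ∷ rest , ↭.prep x σ , x≤m ∷ All.map (ℕ.≤-trans x≤m) m≤rest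
...   | no  x≰m = m , x ∷ rest , ↭.trans (↭.prep x σ) (↭.swap x m ↭.refl) , ℕ.≰⇒≥ x≰m ∷ m≤rest

m≤m^n : ∀ m n .{{_ : NonZero n}} → m ≤ℕ m ^ℕ n
m≤m^n zero    (suc n) = z≤n
m≤m^n (suc m) (suc n) = ℕ.m≤m*n (suc m) _ {{ℕ.m^n≢0 (suc m) n}}

[m*n]^2^k≤m^2^[1+k] : ∀ {m n} k → n ≤ℕ m → (m *ℕ n) ^ℕ (2 ^ℕ k) ≤ℕ m ^ℕ (2 ^ℕ suc k)
[m*n]^2^k≤m^2^[1+k] {m} {n} k n≤m = begin
  (m *ℕ n) ^ℕ (2 ^ℕ k)        ≤⟨ ℕ.^-monoˡ-≤ (2 ^ℕ k) (ℕ.*-monoʳ-≤ m n≤m) ⟩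
  (m *ℕ m) ^ℕ (2 ^ℕ k)        ≡⟨ cong (λ t → (m *ℕ t) ^ℕ (2 ^ℕ k)) (ℕ.*-identityʳ m) ⟨
  (m ^ℕ 2) ^ℕ (2 ^ℕ k)        ≡⟨ ℕ.^-*-assoc m 2 (2 ^ℕ k) ⟩
  m ^ℕ (2 ^ℕ suc k)           ∎
  where open ℕ.≤-Reasoning

*-≤-*-+⇒≤ : ∀ {m n p t} → n <ℕ m → m *ℕ p ≤ℕ n *ℕ p +ℕ t → p ≤ℕ t
*-≤-*-+⇒≤ {m} {n} {p} {t} n<m mp≤np+t =
  ℕ.+-cancelʳ-≤ (n *ℕ p) p t (begin
    p +ℕ n *ℕ p   ≤⟨ ℕ.*-monoˡ-≤ p n<m ⟩
    m *ℕ p        ≤⟨ mp≤np+t ⟩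
    n *ℕ p +ℕ t   ≡⟨ ℕ.+-comm (n *ℕ p) t ⟩
    t +ℕ n *ℕ p   ∎)
  where open ℕ.≤-Reasoning

module _ (r s : ℤ) where

  -- The factor a collects the entries of the original system that have already been substituted.
  Solves : ℤ → List ℤ → Set
  Solves a xs = ∀ {x ys} → xs ↭ x ∷ ys → x ∣ r * (a * prodList ys) - s

  Solves-∷ : ∀ {a x xs} → Solves a (x ∷ xs) → Solves (a * x) xs
  Solves-∷ {a} {x} S {y} {ys} σ =
    subst (λ t → y ∣ r * t - s) (sym (ℤ.*-assoc a x (prodList ys)))
      (S (↭.trans (↭.prep x σ) (↭.swap x y ↭.refl)))

  coprime-of-congruence : ∀ {a x p} → gcd (a * (x * p)) s ≡ 1ℤ → x ∣ r * (a * p) - s → Coprime x p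
  coprime-of-congruence {a} {x} {p} g x∣ {d} (d∣x , d∣p) =
    ℕᵈ.∣1⇒≡1 (subst (+ d Unsigned.∣_) g
      (gcd-greatest {a * (x * p)} {s} {+ d} (∣⇒∣ᵤ d∣axp) (∣⇒∣ᵤ d∣s)))
    where
    d∣x′ : + d ∣ x
    d∣x′ = ∣ᵤ⇒∣ {+ d} {x} d∣x
    d∣axp : + d ∣ a * (x * p)
    d∣axp = ∣n⇒∣m*n a (∣m⇒∣m*n p d∣x′)
    d∣s : + d ∣ s
    d∣s = subst (+ d ∣_) (ℤ.neg-involutive s)
            (∣m⇒∣-m (∣m+n∣m⇒∣n (∣-trans d∣x′ x∣)
                                (∣n⇒∣m*n r (∣n⇒∣m*n a (∣ᵤ⇒∣ {+ d} {p} d∣p)))))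

  coprime⇒*∣ : ∀ {x y z} → Coprime x y → x ∣ z → y ∣ z → x * y ∣ z
  coprime⇒*∣ {x} {y} c x∣z (divides k z≡k*y) = subst (x * y ∣_) (sym z≡k*y) (*-monoˡ-∣ y x∣k)
    where
    x∣k : x ∣ k
    x∣k = ∣ᵤ⇒∣ (coprime-divisor x y k c (∣⇒∣ᵤ (subst (x ∣_) (trans z≡k*y (ℤ.*-comm k y)) x∣z)))

  prodList∣r*a*sumProdExcept-s : ∀ a xs → Solves a xs → gcd (a * prodList xs) s ≡ 1ℤ →
    prodList xs ∣ r * (a * sumProdExcept xs) - s
  prodList∣r*a*sumProdExcept-s a []       S g = divides (r * (a * 0ℤ) - s) (sym (ℤ.*-identityʳ _))
  prodList∣r*a*sumProdExcept-s a (x ∷ xs) S g =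
    coprime⇒*∣ (coprime-of-congruence {a} {x} {p} g x∣ax) x∣ p∣
    where
    p : ℤ
    p = prodList xs
    e : ℤ
    e = sumProdExcept xs
    x∣ax : x ∣ r * (a * p) - s
    x∣ax = S ↭.refl
    p∣ : p ∣ r * (a * (p + x * e)) - s
    p∣ = subst (p ∣_) (sym (split-by-p r a p x e s)) (∣m∣n⇒∣m+n IH (∣m⇒∣m*n (r * a) ∣-refl))
      where
      IH : p ∣ r * ((a * x) * e) - s
      IH = prodList∣r*a*sumProdExcept-s (a * x) xs (Solves-∷ {a} {x} {xs} S)
             (trans (cong (λ t → gcd t s) (ℤ.*-assoc a x p)) g)
      split-by-p : ∀ r a p x e s → r * (a * (p + x * e)) - s ≡ (r * ((a * x) * e) - s) + p * (r * a)
      split-by-p = ℤ-Solver.solve-∀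
    x∣ : x ∣ r * (a * (p + x * e)) - s
    x∣ = subst (x ∣_) (sym (split-by-x r a p x e s)) (∣m∣n⇒∣m+n x∣ax (∣m⇒∣m*n (r * (a * e)) ∣-refl))
      where
      split-by-x : ∀ r a p x e s → r * (a * (p + x * e)) - s ≡ (r * (a * p) - s) + x * (r * (a * e))
      split-by-x = ℤ-Solver.solve-∀

prodList-toList : ∀ {n} (q : Vec ℤ n) → prodList (toList q) ≡ prodVec q
prodList-toList []      = refl
prodList-toList (x ∷ q) = cong (x *_) (prodList-toList q)

prodExcept-suc : ∀ {n} x (q : Vec ℤ n) i → prodExcept (x ∷ q) (suc i) ≡ x * prodExcept q i
prodExcept-suc x q i = cong (λ v → x * prodVec v)
  (tabulate-cong λ j → cong (λ b → if b then 1ℤ else lookup q j) (⌊⌋-map′ _ _ (j ≟ᶠ i)))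

lookup*prodExcept≡prodVec : ∀ {n} (q : Vec ℤ n) i → lookup q i * prodExcept q i ≡ prodVec q
lookup*prodExcept≡prodVec (x ∷ q) zero    =
  cong (x *_) (trans (ℤ.*-identityˡ _) (cong prodVec (tabulate∘lookup q)))
lookup*prodExcept≡prodVec (x ∷ q) (suc i) =
  trans (cong (lookup q i *_) (prodExcept-suc x q i))
    (trans (x∙yz≈y∙xz (lookup q i) x (prodExcept q i)) (cong (x *_) (lookup*prodExcept≡prodVec q i)))

All-toList⁺ : ∀ {P : ℤ → Set} {n} (q : Vec ℤ n) → (∀ i → P (lookup q i)) → All P (toList q)
All-toList⁺ {P} q Pq = All.tabulate λ x∈q →
  let x∈ᵥq = ∈-toList⁻ x∈q in subst P (sym (lookup-index x∈ᵥq)) (Pq (index x∈ᵥq))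

IsSolution⇒Solves : ∀ {r s n} (q : Vec ℤ n) → IsSolution r s q → Solves r s 1ℤ (toList q)
IsSolution⇒Solves {r} {s} {n} q (q≢0 , q∣ , _) {x} {ys} σ =
  subst (λ t → t ∣ r * (1ℤ * prodList ys) - s) (sym x≡qᵢ) (subst (λ t → lookup q i ∣ r * t - s) prodExcept≡ qᵢ∣)
  where
  x∈q : x ∈ᵥ q
  x∈q = ∈-toList⁻ (∈-resp-↭ (↭-sym σ) (here refl))
  i : Fin n
  i = index x∈q
  x≡qᵢ : x ≡ lookup q i
  x≡qᵢ = lookup-index x∈q
  qᵢ∣ : lookup q i ∣ r * prodExcept q i - s
  qᵢ∣ = ∣-trans m∣∣m∣ (∣ᵤ⇒∣ (q∣ i))
  prodExcept≡ : prodExcept q i ≡ 1ℤ * prodList ys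
  prodExcept≡ = trans (ℤ.*-cancelˡ-≡ (lookup q i) _ _ {{≢-nonZeroℤ (q≢0 i)}} (begin
    lookup q i * prodExcept q i ≡⟨ lookup*prodExcept≡prodVec q i ⟩
    prodVec q                   ≡⟨ prodList-toList q ⟨
    prodList (toList q)         ≡⟨ prodList-↭ σ ⟩
    x * prodList ys             ≡⟨ cong (_* prodList ys) x≡qᵢ ⟩
    lookup q i * prodList ys    ∎)) (sym (ℤ.*-identityˡ _))
    where open ≡-Reasoning

gcd≡1⇒∤ : ∀ {r s} → 1 <ℕ ∣ r ∣ → gcd r s ≡ 1ℤ → ¬ r ∣ s
gcd≡1⇒∤ {r} {s} 1<r g r∣s =
  ℕ.<⇒≢ 1<r (sym (ℕᵈ.∣1⇒≡1
    (subst (r Unsigned.∣_) g (gcd-greatest {r} {s} {r} ℕᵈ.∣-refl (∣⇒∣ᵤ r∣s)))))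

Bounded : ℤ → ℕ → ℕ → ℤ → ℤ → Set
Bounded s c k a x = ∣ x ∣ ≤ℕ (c *ℕ ∣ a ∣) ^ℕ (2 ^ℕ k) +ℕ ∣ s ∣

module _ {r s : ℤ} (r∤s : ¬ r ∣ s) where

  ∣prodList∣≤ : ∀ a xs → Solves r s a xs → gcd (a * prodList xs) s ≡ 1ℤ →
    ∣ prodList xs ∣ ≤ℕ ∣ r ∣ *ℕ (∣ a ∣ *ℕ ∣ sumProdExcept xs ∣) +ℕ ∣ s ∣
  ∣prodList∣≤ a xs S g = begin
    ∣ prodList xs ∣          ≤⟨ ℕᵈ.∣⇒≤ {{≢-nonZero (z≢0 ∘ ℤ.∣i∣≡0⇒i≡0)}}
                                  (∣⇒∣ᵤ (prodList∣r*a*sumProdExcept-s r s a xs S g)) ⟩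
    ∣ z ∣                    ≤⟨ ℤ.∣i-j∣≤∣i∣+∣j∣ (r * (a * e)) s ⟩
    ∣ r * (a * e) ∣ +ℕ ∣ s ∣  ≡⟨ cong (_+ℕ ∣ s ∣)
                                  (trans (ℤ.abs-* r (a * e)) (cong (∣ r ∣ *ℕ_) (ℤ.abs-* a e))) ⟩
    ∣ r ∣ *ℕ (∣ a ∣ *ℕ ∣ e ∣) +ℕ ∣ s ∣ ∎
    where
    open ℕ.≤-Reasoning
    e : ℤ
    e = sumProdExcept xs
    z : ℤ
    z = r * (a * e) - s
    z≢0 : z ≢ 0ℤ
    z≢0 z≡0 = r∤s (divides (a * e) (trans (sym (ℤ.i-j≡0⇒i≡j _ s z≡0)) (ℤ.*-comm r (a * e))))

  ∣head∣*∣prodList∣≤ : ∀ c a m rest → Solves r s a (m ∷ rest) → gcd (a * prodList (m ∷ rest)) s ≡ 1ℤ →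
    All (λ y → ∣ m ∣ ≤ℕ ∣ y ∣) rest → ∣ r ∣ *ℕ length (m ∷ rest) ≤ℕ c →
    ∣ m ∣ *ℕ ∣ prodList rest ∣ ≤ℕ (c *ℕ ∣ a ∣) *ℕ ∣ prodList rest ∣ +ℕ ∣ s ∣
  ∣head∣*∣prodList∣≤ c a m rest S g m≤rest rL≤c = begin
    ∣ m ∣ *ℕ p                                    ≡⟨ ℤ.abs-* m (prodList rest) ⟨
    ∣ prodList (m ∷ rest) ∣                       ≤⟨ ∣prodList∣≤ a (m ∷ rest) S g ⟩
    ∣ r ∣ *ℕ (∣ a ∣ *ℕ ∣ sumProdExcept (m ∷ rest) ∣) +ℕ ∣ s ∣
      ≤⟨ ℕ.+-monoˡ-≤ ∣ s ∣ (ℕ.*-monoʳ-≤ ∣ r ∣ (ℕ.*-monoʳ-≤ ∣ a ∣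
           (∣sumProdExcept∣≤-minimum-first {m} {rest} m≤rest))) ⟩
    ∣ r ∣ *ℕ (∣ a ∣ *ℕ (L *ℕ p)) +ℕ ∣ s ∣          ≡⟨ cong (_+ℕ ∣ s ∣) (regroup ∣ r ∣ ∣ a ∣ L p) ⟩
    (∣ r ∣ *ℕ L) *ℕ (∣ a ∣ *ℕ p) +ℕ ∣ s ∣          ≤⟨ ℕ.+-monoˡ-≤ ∣ s ∣ (ℕ.*-monoˡ-≤ (∣ a ∣ *ℕ p) rL≤c) ⟩
    c *ℕ (∣ a ∣ *ℕ p) +ℕ ∣ s ∣                     ≡⟨ cong (_+ℕ ∣ s ∣) (ℕ.*-assoc c ∣ a ∣ p) ⟨
    (c *ℕ ∣ a ∣) *ℕ p +ℕ ∣ s ∣                     ∎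
    where
    open ℕ.≤-Reasoning
    p : ℕ
    p = ∣ prodList rest ∣
    L : ℕ
    L = length (m ∷ rest)
    regroup : ∀ r a L p → r *ℕ (a *ℕ (L *ℕ p)) ≡ (r *ℕ L) *ℕ (a *ℕ p)
    regroup = solve-∀

  module _ (c : ℕ) where

    mutual
      solution-bound : ∀ k a xs → length xs ≡ suc k → All (_≢ 0ℤ) xs → Solves r s a xs →
        gcd (a * prodList xs) s ≡ 1ℤ → ∣ r ∣ *ℕ suc k ≤ℕ c → All (Bounded s c k a) xs
      solution-bound k a (x ∷ xs) len nz S g rk≤c with extract-minimum ∣_∣ x xs
      ... | m , rest , σ , m≤rest =
        All-resp-↭ (↭-sym σ)
          (solution-bound-minimum-first k a m rest (trans (sym (↭-length σ)) len) (All-resp-↭ σ nz)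
            (S ∘ ↭.trans σ) (trans (cong (λ t → gcd (a * t) s) (prodList-↭ (↭-sym σ))) g) rk≤c m≤rest)

      solution-bound-minimum-first : ∀ k a m rest → length (m ∷ rest) ≡ suc k → All (_≢ 0ℤ) (m ∷ rest) →
        Solves r s a (m ∷ rest) → gcd (a * prodList (m ∷ rest)) s ≡ 1ℤ → ∣ r ∣ *ℕ suc k ≤ℕ c →
        All (λ y → ∣ m ∣ ≤ℕ ∣ y ∣) rest → All (Bounded s c k a) (m ∷ rest)
      solution-bound-minimum-first zero a m [] _ _ S g r≤c [] =
        subst (_≤ℕ (c *ℕ ∣ a ∣) *ℕ 1 +ℕ ∣ s ∣) (ℕ.*-identityʳ ∣ m ∣)
          (∣head∣*∣prodList∣≤ c a m [] S g [] r≤c) ∷ []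
      solution-bound-minimum-first (suc k) a m rest@(y ∷ ys) len (_ ∷ nz) S g rk≤c m≤rest
        with ∣ m ∣ ≤? c *ℕ ∣ a ∣
      ... | yes m≤X = small ∷ All.map (λ {x} → weaken x) IH
        where
        X : ℕ
        X = c *ℕ ∣ a ∣
        IH : All (Bounded s c k (a * m)) rest
        IH = solution-bound k (a * m) rest (ℕ.suc-injective len) nz (Solves-∷ r s {a} {m} {rest} S)
               (trans (cong (λ t → gcd t s) (ℤ.*-assoc a m _)) g)
               (ℕ.≤-trans (ℕ.*-monoʳ-≤ ∣ r ∣ (ℕ.n≤1+n (suc k))) rk≤c)
        shrink : (c *ℕ ∣ a * m ∣) ^ℕ (2 ^ℕ k) ≤ℕ X ^ℕ (2 ^ℕ suc k)
        shrink = subst (λ t → t ^ℕ (2 ^ℕ k) ≤ℕ X ^ℕ (2 ^ℕ suc k))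
                   (trans (ℕ.*-assoc c ∣ a ∣ ∣ m ∣) (cong (c *ℕ_) (sym (ℤ.abs-* a m))))
                   ([m*n]^2^k≤m^2^[1+k] k m≤X)
        weaken : ∀ x → Bounded s c k (a * m) x → Bounded s c (suc k) a x
        weaken x x≤ = ℕ.≤-trans x≤ (ℕ.+-monoˡ-≤ ∣ s ∣ shrink)
        small : Bounded s c (suc k) a m
        small = ℕ.≤-trans (ℕ.≤-trans m≤X (m≤m^n X (2 ^ℕ suc k) {{ℕ.m^n≢0 2 (suc k)}})) (ℕ.m≤m+n _ ∣ s ∣)
      ... | no m≰X = below-s m (ℕ.≤-trans (All.head m≤rest) (∈⇒∣∣≤∣prodList∣ nz (here refl)))
                   ∷ All.tabulate (λ {x} x∈rest → below-s x (∈⇒∣∣≤∣prodList∣ nz x∈rest))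
        where
        rL≤c : ∣ r ∣ *ℕ length (m ∷ rest) ≤ℕ c
        rL≤c = subst (λ t → ∣ r ∣ *ℕ t ≤ℕ c) (sym len) rk≤c
        p≤s : ∣ prodList rest ∣ ≤ℕ ∣ s ∣
        p≤s = *-≤-*-+⇒≤ (ℕ.≰⇒> m≰X) (∣head∣*∣prodList∣≤ c a m rest S g m≤rest rL≤c)
        below-s : ∀ x → ∣ x ∣ ≤ℕ ∣ prodList rest ∣ → Bounded s c (suc k) a x
        below-s x x≤p = ℕ.≤-trans (ℕ.≤-trans x≤p p≤s) (ℕ.m≤n+m ∣ s ∣ _)

  IsSolution⇒bound : ∀ {k} (q : Vec ℤ (suc k)) → IsSolution r s q → ∀ i →
    ∣ lookup q i ∣ ≤ℕ (∣ r ∣ *ℕ suc k) ^ℕ (2 ^ℕ k) +ℕ ∣ s ∣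
  IsSolution⇒bound {k} q sol@(q≢0 , _ , gcd≡1) i =
    subst (λ t → ∣ lookup q i ∣ ≤ℕ t ^ℕ (2 ^ℕ k) +ℕ ∣ s ∣) (ℕ.*-identityʳ c)
      (All.lookup bounds (∈-toList⁺ (∈-lookup i q)))
    where
    c : ℕ
    c = ∣ r ∣ *ℕ suc k
    bounds : All (Bounded s c k 1ℤ) (toList q)
    bounds = solution-bound c k 1ℤ (toList q) (length-toList q) (All-toList⁺ q q≢0) (IsSolution⇒Solves {r} {s} q sol)
               (trans (cong (λ t → gcd t s) (trans (ℤ.*-identityˡ _) (prodList-toList q))) gcd≡1) ℕ.≤-refl

integersWithin : ℕ → List ℤ
integersWithin N = map +_ (upTo (suc N)) ++ map (λ k → - + k) (upTo (suc N))

∈-integersWithin : ∀ {z N} → ∣ z ∣ ≤ℕ N → z ∈ integersWithin N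
∈-integersWithin {+ k}      {N} k≤N = ∈-++⁺ˡ (∈-map⁺ +_ (∈-upTo⁺ (s≤s k≤N)))
∈-integersWithin { -[1+ k ]} {N} k<N =
  ∈-++⁺ʳ (map +_ (upTo (suc N))) (∈-map⁺ (λ k → - + k) (∈-upTo⁺ (s≤s k<N)))

vectorsOver : ∀ {A : Set} n → List A → List (Vec A n)
vectorsOver zero    xs = [] ∷ []
vectorsOver (suc n) xs = cartesianProductWith _∷_ xs (vectorsOver n xs)

∈-vectorsOver : ∀ {A : Set} {n} {xs : List A} (v : Vec A n) → (∀ i → lookup v i ∈ xs) → v ∈ vectorsOver n xs
∈-vectorsOver []      _   = here refl
∈-vectorsOver (x ∷ v) v∈ = ∈-cartesianProductWith⁺ _∷_ (v∈ zero) (∈-vectorsOver v (v∈ ∘ suc))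

i≤+∣i∣ : ∀ i → i ≤ + ∣ i ∣
i≤+∣i∣ (+ n)    = +≤+ ℕ.≤-refl
i≤+∣i∣ -[1+ n ] = -≤+

pos-^ : ∀ m n → + (m ^ℕ n) ≡ (+ m) ^ n
pos-^ m zero    = refl
pos-^ m (suc n) = trans (ℤ.pos-* m (m ^ℕ n)) (cong (+ m *_) (pos-^ m n))

theorem1p3 : (n : ℕ) → 2 ≤ℕ n → (r s : ℤ) → + 2 ≤ r → gcd r s ≡ 1ℤ →
    (∃[ L ] ∀ (q : Vec ℤ n) → IsSolution r s q → q ∈ L)
    × (∀ (q : Vec ℤ n) → IsSolution r s q → ∀ i →
         lookup q i ≤ (r * + (suc n)) ^ (2 ^ℕ (n ∸ 1)) + + ∣ s ∣)
theorem1p3 zero    ()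
theorem1p3 (suc k) _ (+ r) s (+≤+ 1<r) gcd≡1 =
    (vectorsOver (suc k) (integersWithin N) , λ q sol → ∈-vectorsOver q (∈-integersWithin ∘ ∣q∣≤N q sol))
  , λ q sol i → ℤ.≤-trans (i≤+∣i∣ (lookup q i))
                          (subst (+ ∣ lookup q i ∣ ≤_) +N≡ (+≤+ (∣q∣≤N q sol i)))
  where
  N : ℕ
  N = (r *ℕ suc (suc k)) ^ℕ (2 ^ℕ k) +ℕ ∣ s ∣
  ∣q∣≤N : ∀ (q : Vec ℤ (suc k)) → IsSolution (+ r) s q → ∀ i → ∣ lookup q i ∣ ≤ℕ N
  ∣q∣≤N q sol i = ℕ.≤-trans (IsSolution⇒bound (gcd≡1⇒∤ {+ r} {s} 1<r gcd≡1) q sol i)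
    (ℕ.+-monoˡ-≤ ∣ s ∣ (ℕ.^-monoˡ-≤ (2 ^ℕ k) (ℕ.*-monoʳ-≤ r (ℕ.n≤1+n (suc k)))))
  +N≡ : + N ≡ (+ r * + suc (suc k)) ^ (2 ^ℕ k) + + ∣ s ∣
  +N≡ = trans (ℤ.pos-+ _ ∣ s ∣)
          (cong (_+ + ∣ s ∣) (trans (pos-^ _ (2 ^ℕ k)) (cong (_^ (2 ^ℕ k)) (ℤ.pos-* r _))))
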